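{- Let $A$ be a finite set with $n=|A|\ge2$ and let $\mathcal V$ be a regular vine on $A$. Then $\mathcal V$ is a D-vine if and only if there is an enumeration $A=\{c_1,\dots,c_n\}$ such that both $$\{c_1\}\subseteq\{c_1,c_2\}\subseteq\cdots\subseteq\{c_1,\dots,c_n\}\quad\text{and}\quad\{c_n\}\subseteq\{c_{n-1},c_n\}\subseteq\cdots\subseteq\{c_1,\dots,c_n\}$$ are maximal chains of $\mathcal V$.
   Context: A regular vine on an $m$-element set $X$ is an induced subposet $\mathcal V$ of $(2^X,\subseteq)$ such that (1) all maximal chains have length $m-1$ and minimal elements have rank 1; (2) $\mathcal V$ has exactly $m$ minimal elements (the singletons; the maximum is $X$); rank = cardinality, $\mathcal V(i)$ = elements of rank $i$; (3) every non-minimal element covers exactly two elements; (4) for $1\le i\le m-1$, the graph on $\mathcal V(i)$ whose edges are the elements of $\mathcal V(i+1)$, each joining the two elements it covers (the $i$-th associated tree), is a tree; (5) if two elements of $\mathcal V(i)$, $i\ge2$, are covered by a common element, they cover a common element. A D-vine is a regular vine all of whose associated trees are path graphs. -}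

module Defs where

open import Data.Nat using (ℕ; zero; suc; _+_; _∸_; _≤_; _<_)
open import Data.Bool using (Bool; true; false)
open import Data.Fin using (Fin; toℕ)
open import Data.Fin.Subset using (Subset; _∈_; _⊆_; _⊂_; ⁅_⁆; ⊤; ∣_∣)
open import Data.List using (List; []; _∷_; _++_; length)
open import Data.List.Membership.Propositional using () renaming (_∈_ to _∈ₗ_)
open import Data.List.Relation.Unary.Unique.Propositional using (Unique)
open import Data.Product using (Σ; ∃; ∃-syntax; _×_; _,_)
open import Data.Sum using (_⊎_)
open import Function.Bundles using (_⇔_; _↔_; Inverse)
open import Relation.Binary.PropositionalEquality using (_≡_; _≢_)
open import Relation.Binary.Construct.Closure.ReflexiveTransitive using (Star)
open import Relation.Nullary using (¬_)
open import Data.Unit using () renaming (⊤ to Unit)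

-- A family of subsets of Fin n (an induced subposet of (2^X, ⊆)),
-- given by its (decidable) membership function.
Family : ℕ → Set
Family n = Subset n → Bool

module _ {n : ℕ} (V : Family n) where

  InV : Subset n → Set
  InV S = V S ≡ true

  IsMinimal : Subset n → Set
  IsMinimal S = InV S × (∀ T → InV T → T ⊆ S → T ≡ S)

  Covers : Subset n → Subset n → Set
  Covers E S = InV E × InV S × S ⊂ E
             × (∀ U → InV U → S ⊂ U → ¬ (U ⊂ E))

  -- the elements of rank (= cardinality) i
  InLevel : ℕ → Subset n → Set
  InLevel i S = InV S × ∣ S ∣ ≡ i

  -- the i-th associated graph: vertices V(i), edges the elements of V(i+1),
  -- each joining the two elements it covers
  Adj : ℕ → Subset n → Subset n → Set
  Adj i S T = InLevel i S × InLevel i T × S ≢ T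
            × ∃[ E ] (InLevel (suc i) E × Covers E S × Covers E T)

  Connected : ℕ → Set
  Connected i = ∀ S T → InLevel i S → InLevel i T → Star (Adj i) S T

  Walk : ℕ → List (Subset n) → Set
  Walk i [] = Unit
  Walk i (S ∷ []) = Unit
  Walk i (S ∷ T ∷ vs) = Adj i S T × Walk i (T ∷ vs)

  HasCycle : ℕ → Set
  HasCycle i = ∃[ vs ] ∃[ v₀ ] ∃[ vₖ ] ∃[ mid ]
               (vs ≡ v₀ ∷ mid ++ vₖ ∷ [] × 1 ≤ length mid × Unique vs
                × Walk i vs × Adj i vₖ v₀)

  IsTree : ℕ → Set
  IsTree i = Connected i × ¬ HasCycle i

  Consecutive : List (Subset n) → Subset n → Subset n → Set
  Consecutive vs S T = ∃[ l ] ∃[ r ] (vs ≡ l ++ S ∷ T ∷ r)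

  IsPathGraph : ℕ → Set
  IsPathGraph i = ∃[ vs ] (Unique vs
                  × (∀ S → InLevel i S ⇔ S ∈ₗ vs)
                  × (∀ S T → Adj i S T ⇔ (Consecutive vs S T ⊎ Consecutive vs T S)))

  record IsRegularVine : Set where
    field
      singletons-in : ∀ (x : Fin n) → InV ⁅ x ⁆
      minimal-singleton : ∀ S → IsMinimal S → ∃[ x ] (S ≡ ⁅ x ⁆)
      top-in : InV ⊤
      -- (1)+(2) rank = cardinality: covering raises cardinality by one
      rank-card : ∀ E S → Covers E S → ∣ E ∣ ≡ suc ∣ S ∣
      two-covers : ∀ E → InV E → ¬ IsMinimal E →
        ∃[ S₁ ] ∃[ S₂ ] (S₁ ≢ S₂ × Covers E S₁ × Covers E S₂
                         × (∀ S → Covers E S → S ≡ S₁ ⊎ S ≡ S₂))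
      trees : ∀ i → 1 ≤ i → i ≤ n ∸ 1 → IsTree i
      proximity : ∀ i → 2 ≤ i → ∀ S T E → InLevel i S → InLevel i T →
        Covers E S → Covers E T → ∃[ U ] (Covers S U × Covers T U)

  IsDVine : Set
  IsDVine = IsRegularVine × (∀ i → 1 ≤ i → i ≤ n ∸ 1 → IsPathGraph i)

  IsMaximalChain : (Subset n → Set) → Set
  IsMaximalChain C =
      (∀ S → C S → InV S)
    × (∀ S T → C S → C T → S ⊆ T ⊎ T ⊆ S)
    × (∀ S → InV S → (∀ T → C T → S ⊆ T ⊎ T ⊆ S) → C S)

-- for an enumeration c of Fin n: the set {c₁,…,c_k} (indices 0-based: c 0,…,c (k-1))
IsPrefix : {n : ℕ} → (Fin n → Fin n) → ℕ → Subset n → Set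
IsPrefix c k S = ∀ x → x ∈ S ⇔ (∃[ j ] (toℕ j < k × c j ≡ x))

IsSuffix : {n : ℕ} → (Fin n → Fin n) → ℕ → Subset n → Set
IsSuffix {n} c k S = ∀ x → x ∈ S ⇔ (∃[ j ] (n ≤ toℕ j + k × c j ≡ x))

PrefixChain : {n : ℕ} → (Fin n → Fin n) → Subset n → Set
PrefixChain {n} c S = ∃[ k ] (1 ≤ k × k ≤ n × IsPrefix c k S)

SuffixChain : {n : ℕ} → (Fin n → Fin n) → Subset n → Set
SuffixChain {n} c S = ∃[ k ] (1 ≤ k × k ≤ n × IsSuffix c k S)

-- an enumeration A = {c₁,…,c_n} of Fin n: a bijection Fin n ↔ Fin n,
-- with c_{j+1} = enum e j
Enumeration : ℕ → Set
Enumeration n = Fin n ↔ Fin n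

enum : {n : ℕ} → Enumeration n → Fin n → Fin n
enum e = Inverse.to e

-- Call V an interval vine for an enumeration c of A when its elements are exactly the intervals
-- {c_{a+1}, …, c_{a+k}}, k ≥ 1. Each interval of length k + 1 covers the two intervals obtained by
-- dropping its first or its last element, so every tree of an interval vine is the path of the
-- intervals of one length in their natural order, and the prefix and suffix chains are maximal
-- chains: an element comparable with the prefix (suffix) of its own size equals it.
--
-- If V is a D-vine, enumerate A along the path formed by the first tree and go up in rank. An
-- element of rank i + 1 covers two intervals of length i; these are consecutive (for i ≥ 2 since
-- their union has only i + 1 elements, for i = 1 since the first tree is the path), so it is their
-- union, an interval. Hence every edge of the i-th tree joins consecutive intervals, and a walk in
-- that connected tree from the interval at position a to the one at a + 1 must use the edge
-- between them, which is the interval of length i + 1 at position a.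
--
-- If both chains are maximal, go down from rank n. An interval of length i that is neither a
-- prefix nor a suffix is, by proximity, the element covered by both intervals of length i + 1
-- containing it; and an element of rank i < n is covered by some element of rank i + 1 (the
-- i-th tree is connected), which is an interval and covers only its two subintervals.

module Submission where

open import Defs
open import Data.Nat using (ℕ; _≤_)
open import Data.Product using (Σ; ∃; ∃-syntax; _×_)
open import Function.Bundles using (_⇔_)

open import Axiom.UniquenessOfIdentityProofs using (module Decidable⇒UIP)
import Data.Bool.Properties as Bool
open import Data.Nat using (zero; suc; _+_; _∸_; _<_; z≤n; s≤s; z<s; _≟_; _≤?_; _<?_)
open import Data.Nat.Properties hiding (_≟_)
open import Data.Fin using (Fin; zero; suc; toℕ; fromℕ<)
import Data.Fin.Properties as Fin
open import Data.Fin.Subset using (Subset; inside; outside; _∈_; _∉_; _⊆_; _⊂_; ⁅_⁆; ∣_∣; _-_)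
open import Data.Fin.Subset.Properties
  using (_∈?_; ⊆-antisym; ⊆-reflexive; ⊆-min; nonempty?; Empty-unique; ∉⊥; x∈⁅x⁆; x∈⁅y⁆⇒x≡y;
         ∣⊥∣≡0; ∣⁅x⁆∣≡1; ∣p∣≤n; p⊆q⇒∣p∣≤∣q∣; p⊂q⇒∣p∣<∣q∣; p─⊥≡p; p─q⊆p; x∈p∧x≢y⇒x∈p-y)
open import Data.List using (List; []; _∷_; _++_; length; lookup; applyUpTo)
open import Data.List.Properties using (∷-injectiveˡ; ∷-injectiveʳ)
open import Data.List.Relation.Unary.Any using (here; there; index)
open import Data.List.Relation.Unary.Any.Properties using (lookup-index)
open import Data.List.Relation.Unary.Unique.Propositional using (Unique)
open import Data.List.Relation.Unary.Unique.Propositional.Properties using (applyUpTo⁺₁)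
open import Data.List.Membership.Propositional using () renaming (_∈_ to _∈ₗ_)
open import Data.List.Membership.Propositional.Properties
  using (∈-lookup; ∈-++⁺ʳ; ∈-applyUpTo⁺; ∈-applyUpTo⁻)
open import Data.List.Membership.Setoid.Properties using (unique⇒irrelevant)
open import Data.Product using (_,_; proj₁; proj₂)
open import Data.Sum using (_⊎_; inj₁; inj₂; [_,_]; swap)
open import Data.Vec using (_∷_; tabulate; here; there)
open import Data.Vec.Properties using (lookup∘tabulate; []=⇒lookup; lookup⇒[]=; ≡-dec)
open import Function using (_∘_)
open import Function.Bundles using (Equivalence; Inverse; mk⇔; mk↔ₛ′)
open import Function.Construct.Composition using (_⇔-∘_)
open import Function.Construct.Symmetry using (⇔-sym)
open import Function.Definitions using (Injective)
open import Level using (Level)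
open import Relation.Binary.Construct.Closure.ReflexiveTransitive using (Star; ε; _◅_)
open import Relation.Binary.Definitions using (DecidableEquality; tri<; tri≈; tri>)
open import Relation.Binary.PropositionalEquality hiding ([_])
open import Relation.Nullary using (¬_; yes; no; does; proof; contradiction)
open import Relation.Nullary.Decidable using (dec-true; _×-dec_)
open import Relation.Nullary.Reflects using (Reflects; invert)
open import Relation.Unary using (Pred; Decidable)

m<n⇒m≤n∸1 : ∀ {m n} → m < n → m ≤ n ∸ 1
m<n⇒m≤n∸1 (s≤s m≤n) = m≤n

m+1+n≤o⇒m+n<o : ∀ {m n o} → m + suc n ≤ o → m + n < o
m+1+n≤o⇒m+n<o {m} {n} {o} = subst (_≤ o) (+-suc m n)

m+n<o⇒m+1+n≤o : ∀ m n {o} → m + n < o → m + suc n ≤ o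
m+n<o⇒m+1+n≤o m n {o} = subst (_≤ o) (sym (+-suc m n))

x∉p-x : ∀ {n} {x : Fin n} {p} → x ∉ p - x
x∉p-x {x = zero}  {p = _ ∷ _} ()
x∉p-x {x = suc x} {p = _ ∷ _} (there x∈p-x) = x∉p-x x∈p-x

∣p∣≡suc∣p-x∣ : ∀ {n} {x : Fin n} {p} → x ∈ p → ∣ p ∣ ≡ suc ∣ p - x ∣
∣p∣≡suc∣p-x∣ {p = inside ∷ p}  here        = cong (suc ∘ ∣_∣) (sym (p─⊥≡p p))
∣p∣≡suc∣p-x∣ {p = inside ∷ p}  (there x∈p) = cong suc (∣p∣≡suc∣p-x∣ x∈p)
∣p∣≡suc∣p-x∣ {p = outside ∷ p} (there x∈p) = ∣p∣≡suc∣p-x∣ x∈p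

module _ {n : ℕ} where

  private
    variable
      ℓ : Level
      p q : Subset n
      x y : Fin n

  subset-ext : (∀ x → x ∈ p ⇔ x ∈ q) → p ≡ q
  subset-ext p⇔q = ⊆-antisym (Equivalence.to (p⇔q _)) (Equivalence.from (p⇔q _))

  ⊆∧∣∣≤⇒≡ : p ⊆ q → ∣ q ∣ ≤ ∣ p ∣ → p ≡ q
  ⊆∧∣∣≤⇒≡ {p = p} {q} p⊆q ∣q∣≤∣p∣ = ⊆-antisym p⊆q q⊆p
    where
    q⊆p : q ⊆ p
    q⊆p {x} x∈q with x ∈? p
    ... | yes x∈p = x∈p
    ... | no  x∉p = contradiction (p⊂q⇒∣p∣<∣q∣ (p⊆q , x , x∈q , x∉p)) (≤⇒≯ ∣q∣≤∣p∣)

  comparable∧∣∣≡⇒≡ : p ⊆ q ⊎ q ⊆ p → ∣ p ∣ ≡ ∣ q ∣ → p ≡ q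
  comparable∧∣∣≡⇒≡ (inj₁ p⊆q) ∣p∣≡∣q∣ = ⊆∧∣∣≤⇒≡ p⊆q (≤-reflexive (sym ∣p∣≡∣q∣))
  comparable∧∣∣≡⇒≡ (inj₂ q⊆p) ∣p∣≡∣q∣ = sym (⊆∧∣∣≤⇒≡ q⊆p (≤-reflexive ∣p∣≡∣q∣))

  ∣q∣≡suc∣p∣⇒new-unique : p ⊆ q → ∣ q ∣ ≡ suc ∣ p ∣ →
    x ∈ q → x ∉ p → y ∈ q → y ∉ p → y ≡ x
  ∣q∣≡suc∣p∣⇒new-unique {p = p} {q} {x} {y} p⊆q ∣q∣≡ x∈q x∉p y∈q y∉p with y Fin.≟ x
  ... | yes y≡x = y≡x
  ... | no  y≢x = contradiction (subst (y ∈_) (sym p≡q-x) (x∈p∧x≢y⇒x∈p-y y∈q y≢x)) y∉p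
    where
    p≡q-x : p ≡ q - x
    p≡q-x = ⊆∧∣∣≤⇒≡ (λ z∈p → x∈p∧x≢y⇒x∈p-y (p⊆q z∈p) (λ { refl → x∉p z∈p }))
              (≤-reflexive (suc-injective (trans (sym (∣p∣≡suc∣p-x∣ x∈q)) ∣q∣≡)))

  ⁅⁆-injective : ⁅ x ⁆ ≡ ⁅ y ⁆ → x ≡ y
  ⁅⁆-injective {x = x} {y} ⁅x⁆≡⁅y⁆ = x∈⁅y⁆⇒x≡y y (subst (x ∈_) ⁅x⁆≡⁅y⁆ (x∈⁅x⁆ x))

  ∣p∣≡1⇒singleton : ∀ {p : Subset n} → ∣ p ∣ ≡ 1 → ∃[ x ] p ≡ ⁅ x ⁆
  ∣p∣≡1⇒singleton {p} ∣p∣≡1 with nonempty? p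
  ... | yes (x , x∈p) = x , sym (⊆∧∣∣≤⇒≡ (λ y∈⁅x⁆ → subst (_∈ p) (sym (x∈⁅y⁆⇒x≡y x y∈⁅x⁆)) x∈p)
                                           (≤-reflexive (trans ∣p∣≡1 (sym (∣⁅x⁆∣≡1 x)))))
  ... | no  p-empty =
    contradiction (trans (sym (trans (cong ∣_∣ (Empty-unique p-empty)) (∣⊥∣≡0 n))) ∣p∣≡1) 0≢1+n

  comprehension : {P : Pred (Fin n) ℓ} → Decidable P → Subset n
  comprehension P? = tabulate (does ∘ P?)

  ∈-comprehension : {P : Pred (Fin n) ℓ} (P? : Decidable P) → x ∈ comprehension P? ⇔ P x
  ∈-comprehension {x = x} P? = mk⇔
    (λ x∈ → invert (subst (Reflects _) (trans (sym (lookup∘tabulate _ x)) ([]=⇒lookup x∈)) (proof (P? x))))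
    (λ Px → lookup⇒[]= x _ (trans (lookup∘tabulate _ x) (dec-true (P? x) Px)))

  ChainOf : (ℕ → Subset n) → Subset n → Set
  ChainOf C S = ∃[ k ] (1 ≤ k × k ≤ n × S ≡ C k)

module _ {n : ℕ} (V : Family n) where

  isMaximalChain-resp-⇔ : {C D : Subset n → Set} → (∀ S → C S ⇔ D S) →
    IsMaximalChain V C → IsMaximalChain V D
  isMaximalChain-resp-⇔ C⇔D (C⊆V , C-chain , C-maximal) =
    (λ S DS → C⊆V S (from S DS)) ,
    (λ S T DS DT → C-chain S T (from S DS) (from T DT)) ,
    (λ S S∈V comparable → to S (C-maximal S S∈V (λ T CT → comparable T (to T CT))))
    where
    to   = λ S → Equivalence.to (C⇔D S)
    from = λ S → Equivalence.from (C⇔D S)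

  chainOf-maximal : (C : ℕ → Subset n) →
    (∀ {k k′} → k ≤ k′ → k′ ≤ n → C k ⊆ C k′) → (∀ {k} → k ≤ n → ∣ C k ∣ ≡ k) →
    (∀ {k} → 1 ≤ k → k ≤ n → InV V (C k)) → (∀ {S} → InV V S → 1 ≤ ∣ S ∣) →
    IsMaximalChain V (ChainOf C)
  chainOf-maximal C C-mono ∣C∣ C∈V V-nonempty = members , nested , maximal
    where
    members : ∀ S → ChainOf C S → InV V S
    members _ (_ , 1≤k , k≤n , refl) = C∈V 1≤k k≤n
    nested : ∀ S T → ChainOf C S → ChainOf C T → S ⊆ T ⊎ T ⊆ S
    nested _ _ (k , _ , k≤n , refl) (k′ , _ , k′≤n , refl) with ≤-total k k′
    ... | inj₁ k≤k′ = inj₁ (C-mono k≤k′ k′≤n)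
    ... | inj₂ k′≤k = inj₂ (C-mono k′≤k k≤n)
    maximal : ∀ S → InV V S → (∀ T → ChainOf C T → S ⊆ T ⊎ T ⊆ S) → ChainOf C S
    maximal S S∈V comparable =
      ∣ S ∣ , V-nonempty S∈V , ∣p∣≤n S ,
      comparable∧∣∣≡⇒≡ (comparable _ (∣ S ∣ , V-nonempty S∈V , ∣p∣≤n S , refl)) (sym (∣C∣ (∣p∣≤n S)))

  ⊂∧∣∣≡suc⇒covers : ∀ {E S} → InV V E → InV V S → S ⊂ E → ∣ E ∣ ≡ suc ∣ S ∣ → Covers V E S
  ⊂∧∣∣≡suc⇒covers E∈V S∈V S⊂E ∣E∣≡ = E∈V , S∈V , S⊂E , λ U _ S⊂U U⊂E →
    <⇒≱ (p⊂q⇒∣p∣<∣q∣ U⊂E) (subst (_≤ _) (sym ∣E∣≡) (p⊂q⇒∣p∣<∣q∣ S⊂U))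

  covers⇒⊆ : ∀ {E S} → Covers V E S → S ⊆ E
  covers⇒⊆ (_ , _ , (S⊆E , _) , _) = S⊆E

  adj-sym : ∀ {i S T} → Adj V i S T → Adj V i T S
  adj-sym (S-level , T-level , S≢T , E , E-level , E-covers-S , E-covers-T) =
    T-level , S-level , S≢T ∘ sym , E , E-level , E-covers-T , E-covers-S

module RegularVine {n : ℕ} {V : Family n} (rv : IsRegularVine V) where
  open IsRegularVine rv

  private
    variable
      i : ℕ
      E L R S T : Subset n

  ∈V⇒1≤∣∣ : InV V S → 1 ≤ ∣ S ∣
  ∈V⇒1≤∣∣ {S} S∈V with nonempty? S
  ... | yes (x , x∈S) = subst (_≤ ∣ S ∣) (∣⁅x⁆∣≡1 x)
                          (p⊆q⇒∣p∣≤∣q∣ λ y∈⁅x⁆ → subst (_∈ S) (sym (x∈⁅y⁆⇒x≡y x y∈⁅x⁆)) x∈S)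
  ... | no  S-empty with Empty-unique S-empty
  ...   | refl with minimal-singleton S (S∈V , λ T _ T⊆⊥ → ⊆-antisym T⊆⊥ (⊆-min T))
  ...     | x , ⊥≡⁅x⁆ = contradiction (subst (x ∈_) (sym ⊥≡⁅x⁆) (x∈⁅x⁆ x)) ∉⊥

  ¬minimal : InV V E → 2 ≤ ∣ E ∣ → ¬ IsMinimal V E
  ¬minimal E∈V 2≤∣E∣ E-minimal with minimal-singleton _ E-minimal
  ... | x , refl = <⇒≱ 2≤∣E∣ (≤-reflexive (∣⁅x⁆∣≡1 x))

  covers-one-of : 2 ≤ ∣ E ∣ → Covers V E L → Covers V E R → L ≢ R → Covers V E S → S ≡ L ⊎ S ≡ R
  covers-one-of {E} 2≤∣E∣ E-covers-L E-covers-R L≢R E-covers-S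
    with two-covers E (proj₁ E-covers-L) (¬minimal (proj₁ E-covers-L) 2≤∣E∣)
  ... | _ , _ , _ , _ , _ , only-two
    with only-two _ E-covers-L | only-two _ E-covers-R | only-two _ E-covers-S
  ... | inj₁ refl | inj₁ refl | _      = contradiction refl L≢R
  ... | inj₂ refl | inj₂ refl | _      = contradiction refl L≢R
  ... | inj₁ refl | inj₂ refl | S≡S₁⊎S≡S₂ = S≡S₁⊎S≡S₂
  ... | inj₂ refl | inj₁ refl | S≡S₂⊎S≡S₁ = swap S≡S₂⊎S≡S₁

  covered-level : Covers V E S → ∣ E ∣ ≡ suc i → InLevel V i S
  covered-level E-covers-S ∣E∣≡ =
    proj₁ (proj₂ E-covers-S) , suc-injective (trans (sym (rank-card _ _ E-covers-S)) ∣E∣≡)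

  level₁⇔singleton : InLevel V 1 S ⇔ (∃[ x ] S ≡ ⁅ x ⁆)
  level₁⇔singleton = mk⇔ (λ (_ , ∣S∣≡1) → ∣p∣≡1⇒singleton ∣S∣≡1)
                         (λ { (x , refl) → singletons-in x , ∣⁅x⁆∣≡1 x })

  covered-at-next-level : 1 ≤ i → i < n → InLevel V i S → InLevel V i T → S ≢ T →
    ∃[ E ] (InLevel V (suc i) E × Covers V E S)
  covered-at-next-level {i} {S} {T} 1≤i i<n S-level T-level S≢T
    with proj₁ (trees i 1≤i (m<n⇒m≤n∸1 i<n)) S T S-level T-level
  ... | ε = contradiction refl S≢T
  ... | (_ , _ , _ , E , E-level , E-covers-S , _) ◅ _ = E , E-level , E-covers-S

module _ {A : Set} where

  applyUpTo-consecutive⁺ : ∀ (f : ℕ → A) {m b} → suc b < m →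
    ∃[ l ] ∃[ r ] (applyUpTo f m ≡ l ++ f b ∷ f (suc b) ∷ r)
  applyUpTo-consecutive⁺ f {suc (suc m)} {zero}  _ = [] , applyUpTo (λ c → f (suc (suc c))) m , refl
  applyUpTo-consecutive⁺ f {suc m}       {suc b} (s≤s b+1<m)
    with applyUpTo-consecutive⁺ (λ c → f (suc c)) b+1<m
  ... | l , r , eq = f 0 ∷ l , r , cong (f 0 ∷_) eq

  applyUpTo-consecutive⁻ : ∀ (f : ℕ → A) m {l x y r} → applyUpTo f m ≡ l ++ x ∷ y ∷ r →
    ∃[ b ] (suc b < m × x ≡ f b × y ≡ f (suc b))
  applyUpTo-consecutive⁻ f zero          {[]}    ()
  applyUpTo-consecutive⁻ f (suc zero)    {[]}    ()
  applyUpTo-consecutive⁻ f (suc (suc m)) {[]}    eq =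
    0 , s≤s (s≤s z≤n) , sym (∷-injectiveˡ eq) , sym (∷-injectiveˡ (∷-injectiveʳ eq))
  applyUpTo-consecutive⁻ f zero          {_ ∷ _} ()
  applyUpTo-consecutive⁻ f (suc m)       {_ ∷ l} eq
    with applyUpTo-consecutive⁻ (λ c → f (suc c)) m (∷-injectiveʳ eq)
  ... | b , b+1<m , x≡ , y≡ = suc b , s≤s b+1<m , x≡ , y≡

  index-∈-lookup : ∀ (xs : List A) j → index (∈-lookup {xs = xs} j) ≡ j
  index-∈-lookup (_ ∷ _)  zero    = refl
  index-∈-lookup (_ ∷ xs) (suc j) = cong suc (index-∈-lookup xs j)

  index-∈-++⁺ʳ : ∀ (l : List A) {xs y} (p : y ∈ₗ xs) → toℕ (index (∈-++⁺ʳ l p)) ≡ length l + toℕ (index p)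
  index-∈-++⁺ʳ []      p = refl
  index-∈-++⁺ʳ (_ ∷ l) p = cong suc (index-∈-++⁺ʳ l p)

↔-fromInverses : ∀ {m n} → m ≡ n → (f : Fin n → Fin m) (g : Fin m → Fin n) →
  (∀ x → g (f x) ≡ x) → (∀ j → f (g j) ≡ j) →
  Σ (Enumeration n) λ e → ∀ x → toℕ (Inverse.from e x) ≡ toℕ (f x)
↔-fromInverses refl f g g∘f f∘g = mk↔ₛ′ g f g∘f f∘g , λ _ → refl

module ListEnumeration {A : Set} (_≟_ : DecidableEquality A) {n : ℕ} {h : Fin n → A}
  (h-injective : Injective _≡_ _≡_ h) {xs : List A} (xs-unique : Unique xs)
  (h∈xs : ∀ x → h x ∈ₗ xs) (xs⊆h : ∀ {y} → y ∈ₗ xs → ∃[ x ] y ≡ h x) where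

  index-unique : ∀ {y z} (p : y ∈ₗ xs) (q : z ∈ₗ xs) → y ≡ z → index p ≡ index q
  index-unique p q refl =
    cong index (unique⇒irrelevant (setoid A) (Decidable⇒UIP.≡-irrelevant _≟_) xs-unique p q)

  private
    toIndex : Fin n → Fin (length xs)
    toIndex x = index (h∈xs x)

    fromIndex : Fin (length xs) → Fin n
    fromIndex j = proj₁ (xs⊆h (∈-lookup j))

    h∘fromIndex : ∀ j → h (fromIndex j) ≡ lookup xs j
    h∘fromIndex j = sym (proj₂ (xs⊆h (∈-lookup j)))

    fromIndex∘toIndex : ∀ x → fromIndex (toIndex x) ≡ x
    fromIndex∘toIndex x = h-injective (trans (h∘fromIndex _) (sym (lookup-index (h∈xs x))))

    toIndex∘fromIndex : ∀ j → toIndex (fromIndex j) ≡ j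
    toIndex∘fromIndex j = trans (index-unique (h∈xs _) (∈-lookup j) (h∘fromIndex j)) (index-∈-lookup xs j)

    n≡length : n ≡ length xs
    n≡length = Fin.cantor-schröder-bernstein
      (λ {x} {y} eq → trans (sym (fromIndex∘toIndex x)) (trans (cong fromIndex eq) (fromIndex∘toIndex y)))
      (λ {i} {j} eq → trans (sym (toIndex∘fromIndex i)) (trans (cong toIndex eq) (toIndex∘fromIndex j)))

    enumeration : Σ (Enumeration n) λ e → ∀ x → toℕ (Inverse.from e x) ≡ toℕ (toIndex x)
    enumeration = ↔-fromInverses (sym n≡length) toIndex fromIndex fromIndex∘toIndex toIndex∘fromIndex

  listEnumeration : Enumeration n
  listEnumeration = proj₁ enumeration

  position : Fin n → ℕ
  position x = toℕ (Inverse.from listEnumeration x)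

  position≡index : ∀ {ys x} → ys ≡ xs → (p : h x ∈ₗ ys) → position x ≡ toℕ (index p)
  position≡index refl p = trans (proj₂ enumeration _) (cong toℕ (index-unique (h∈xs _) p refl))

  position-consecutive : ∀ l {x y r} → l ++ h x ∷ h y ∷ r ≡ xs → position y ≡ suc (position x)
  position-consecutive l eq = begin
    position _                                       ≡⟨ position≡index eq (∈-++⁺ʳ l (there (here refl))) ⟩
    toℕ (index (∈-++⁺ʳ l (there (here refl))))       ≡⟨ index-∈-++⁺ʳ l (there (here refl)) ⟩
    length l + 1                                     ≡⟨ +-suc (length l) 0 ⟩
    suc (length l + 0)                               ≡⟨ cong suc (index-∈-++⁺ʳ l (here refl)) ⟨
    suc (toℕ (index (∈-++⁺ʳ l (here refl))))         ≡⟨ cong suc (position≡index eq (∈-++⁺ʳ l (here refl))) ⟨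
    suc (position _)                                 ∎
    where open ≡-Reasoning

module Intervals {n : ℕ} (e : Enumeration n) where

  private
    variable
      a b k k′ : ℕ
      x y : Fin n
      E : Subset n

  pos : Fin n → ℕ
  pos x = toℕ (Inverse.from e x)

  pos<n : ∀ x → pos x < n
  pos<n x = Fin.toℕ<n (Inverse.from e x)

  pos-injective : pos x ≡ pos y → x ≡ y
  pos-injective {x} {y} eq = begin
    x                                      ≡⟨ Inverse.strictlyInverseˡ e x ⟨
    Inverse.to e (Inverse.from e x)        ≡⟨ cong (Inverse.to e) (Fin.toℕ-injective eq) ⟩
    Inverse.to e (Inverse.from e y)        ≡⟨ Inverse.strictlyInverseˡ e y ⟩
    y                                      ∎
    where open ≡-Reasoning

  pos-enum : ∀ j → pos (enum e j) ≡ toℕ j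
  pos-enum j = cong toℕ (Inverse.strictlyInverseʳ e j)

  at : a < n → Fin n
  at a<n = enum e (fromℕ< a<n)

  pos-at : (a<n : a < n) → pos (at a<n) ≡ a
  pos-at a<n = trans (pos-enum (fromℕ< a<n)) (Fin.toℕ-fromℕ< a<n)

  -- interval a k is {c_{a+1}, …, c_{a+k}} in the paper's 1-based notation; it is opaque so that
  -- a and k can be inferred from a proof of x ∈ interval a k.
  opaque
    interval : ℕ → ℕ → Subset n
    interval a k = comprehension (λ x → (a ≤? pos x) ×-dec (pos x <? a + k))

    ∈-interval : ∀ {a k x} → x ∈ interval a k ⇔ (a ≤ pos x × pos x < a + k)
    ∈-interval {a} {k} = ∈-comprehension (λ x → (a ≤? pos x) ×-dec (pos x <? a + k))

  ∈-interval⁺ : a ≤ pos x → pos x < a + k → x ∈ interval a k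
  ∈-interval⁺ a≤x x<a+k = Equivalence.from ∈-interval (a≤x , x<a+k)

  ∈-interval⁻ : x ∈ interval a k → a ≤ pos x × pos x < a + k
  ∈-interval⁻ = Equivalence.to ∈-interval

  at∈interval : ∀ {c} (c<n : c < n) → a ≤ c → c < a + k → at c<n ∈ interval a k
  at∈interval c<n a≤c c<a+k =
    ∈-interval⁺ (subst (_ ≤_) (sym (pos-at c<n)) a≤c) (subst (_< _) (sym (pos-at c<n)) c<a+k)

  first∈interval : (a<n : a < n) → at a<n ∈ interval a (suc k)
  first∈interval {a} a<n = at∈interval a<n ≤-refl (m<m+n a z<s)

  last∈interval : (a+k<n : a + k < n) → at a+k<n ∈ interval a (suc k)
  last∈interval {a} {k} a+k<n = at∈interval a+k<n (m≤m+n a k) (+-monoʳ-< a ≤-refl)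

  interval-mono : b ≤ a → a + k ≤ b + k′ → interval a k ⊆ interval b k′
  interval-mono b≤a a+k≤b+k′ x∈ =
    ∈-interval⁺ (≤-trans b≤a (proj₁ (∈-interval⁻ x∈))) (<-≤-trans (proj₂ (∈-interval⁻ x∈)) a+k≤b+k′)

  interval-bounds : 1 ≤ k → a + k ≤ n → interval a k ⊆ interval b k′ → b ≤ a × a + k ≤ b + k′
  interval-bounds {suc k} {a} {b} {k′} _ a+k+1≤n a⊆b = b≤a , a+k<b+k′
    where
    a+k<n : a + k < n
    a+k<n = m+1+n≤o⇒m+n<o a+k+1≤n
    a<n : a < n
    a<n = ≤-<-trans (m≤m+n a k) a+k<n
    b≤a : b ≤ a
    b≤a = subst (b ≤_) (pos-at a<n) (proj₁ (∈-interval⁻ (a⊆b (first∈interval a<n))))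
    a+k<b+k′ : a + suc k ≤ b + k′
    a+k<b+k′ = subst (_≤ b + k′) (sym (+-suc a k))
                 (subst (_< b + k′) (pos-at a+k<n) (proj₂ (∈-interval⁻ (a⊆b (last∈interval a+k<n)))))

  interval-injective : 1 ≤ k → a + k ≤ n → b + k ≤ n → interval a k ≡ interval b k → a ≡ b
  interval-injective 1≤k a+k≤n b+k≤n a≡b = ≤-antisym
    (proj₁ (interval-bounds 1≤k b+k≤n (⊆-reflexive (sym a≡b))))
    (proj₁ (interval-bounds 1≤k a+k≤n (⊆-reflexive a≡b)))

  interval-suc-last : (a+k<n : a + k < n) → interval a (suc k) - at a+k<n ≡ interval a k
  interval-suc-last {a} {k} a+k<n = subset-ext λ x → mk⇔ (shrink x) grow
    where
    last = at a+k<n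
    shrink : ∀ x → x ∈ interval a (suc k) - last → x ∈ interval a k
    shrink x x∈ with ∈-interval⁻ (p─q⊆p _ _ x∈)
    ... | a≤x , x<a+1+k = ∈-interval⁺ a≤x (≤∧≢⇒< (≤-pred (subst (pos x <_) (+-suc a k) x<a+1+k)) x≢last)
      where
      x≢last : pos x ≢ a + k
      x≢last eq = x∉p-x (subst (_∈ _) (pos-injective (trans eq (sym (pos-at a+k<n)))) x∈)
    grow : x ∈ interval a k → x ∈ interval a (suc k) - last
    grow x∈ = x∈p∧x≢y⇒x∈p-y (interval-mono ≤-refl (+-monoʳ-≤ a (n≤1+n k)) x∈)
      λ { refl → <-irrefl (pos-at a+k<n) (proj₂ (∈-interval⁻ x∈)) }

  ∣interval∣ : a + k ≤ n → ∣ interval a k ∣ ≡ k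
  ∣interval∣ {a} {zero} _ = trans (cong ∣_∣ (Empty-unique λ (_ , x∈) → empty x∈)) (∣⊥∣≡0 n)
    where
    empty : x ∉ interval a 0
    empty x∈ with ∈-interval⁻ x∈
    ... | a≤x , x<a+0 = <⇒≱ x<a+0 (subst (_≤ _) (sym (+-identityʳ a)) a≤x)
  ∣interval∣ {a} {suc k} a+k≤n = begin
    ∣ interval a (suc k) ∣                 ≡⟨ ∣p∣≡suc∣p-x∣ (last∈interval a+k<n) ⟩
    suc ∣ interval a (suc k) - at a+k<n ∣  ≡⟨ cong (suc ∘ ∣_∣) (interval-suc-last a+k<n) ⟩
    suc ∣ interval a k ∣                   ≡⟨ cong suc (∣interval∣ (<⇒≤ a+k<n)) ⟩
    suc k                                  ∎
    where
    open ≡-Reasoning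
    a+k<n : a + k < n
    a+k<n = m+1+n≤o⇒m+n<o a+k≤n

  pos<⇒∉interval : pos x < a → x ∉ interval a k
  pos<⇒∉interval x<a x∈ = <⇒≱ x<a (proj₁ (∈-interval⁻ x∈))

  ≤pos⇒∉interval : a + k ≤ pos x → x ∉ interval a k
  ≤pos⇒∉interval a+k≤x x∈ = <⇒≱ (proj₂ (∈-interval⁻ x∈)) a+k≤x

  interval⊂interval-sucʳ : a + suc k ≤ n → interval a k ⊂ interval a (suc k)
  interval⊂interval-sucʳ {a} {k} a+k+1≤n =
    interval-mono ≤-refl (+-monoʳ-≤ a (n≤1+n k)) , at a+k<n , last∈interval a+k<n ,
    ≤pos⇒∉interval (≤-reflexive (sym (pos-at a+k<n)))
    where
    a+k<n : a + k < n
    a+k<n = m+1+n≤o⇒m+n<o a+k+1≤n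

  interval⊂interval-sucˡ : a + suc k ≤ n → interval (suc a) k ⊂ interval a (suc k)
  interval⊂interval-sucˡ {a} {k} a+k+1≤n =
    interval-mono (n≤1+n a) (≤-reflexive (sym (+-suc a k))) , at a<n , first∈interval a<n ,
    pos<⇒∉interval (≤-reflexive (cong suc (pos-at a<n)))
    where
    a<n : a < n
    a<n = ≤-<-trans (m≤m+n a k) (m+1+n≤o⇒m+n<o a+k+1≤n)

  interval⊆interval-suc⇒ : 1 ≤ k → a + k ≤ n → interval a k ⊆ interval b (suc k) → a ≡ b ⊎ a ≡ suc b
  interval⊆interval-suc⇒ {k} {a} {b} 1≤k a+k≤n a⊆b with interval-bounds 1≤k a+k≤n a⊆b
  ... | b≤a , a+k≤b+1+k with m≤n⇒m<n∨m≡n (+-cancelʳ-≤ k a (suc b) (subst (a + k ≤_) (+-suc b k) a+k≤b+1+k))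
  ...   | inj₁ a<1+b = inj₁ (≤-antisym (≤-pred a<1+b) b≤a)
  ...   | inj₂ a≡1+b = inj₂ a≡1+b

  interval-∩ : x ∈ interval a (suc k) → x ∈ interval (suc a) (suc k) → x ∈ interval (suc a) k
  interval-∩ {x = x} {a = a} {k} x∈ x∈′ =
    ∈-interval⁺ (proj₁ (∈-interval⁻ x∈′)) (subst (pos x <_) (+-suc a k) (proj₂ (∈-interval⁻ x∈)))

  interval-∪ : 1 ≤ k → x ∈ interval a (suc k) → x ∈ interval a k ⊎ x ∈ interval (suc a) k
  interval-∪ {k} {x} {a} 1≤k x∈ with ∈-interval⁻ x∈ | pos x <? a + k
  ... | a≤x , _     | yes x<a+k = inj₁ (∈-interval⁺ a≤x x<a+k)
  ... | _ , x<a+1+k | no  x≮a+k = inj₂ (∈-interval⁺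
    (≤-trans (subst (_≤ a + k) (+-comm a 1) (+-monoʳ-≤ a 1≤k)) (≮⇒≥ x≮a+k))
    (subst (pos x <_) (+-suc a k) x<a+1+k))

  ⁅x⁆≡interval : ⁅ x ⁆ ≡ interval (pos x) 1
  ⁅x⁆≡interval {x} = subset-ext λ y → mk⇔
    (λ y∈⁅x⁆ → subst (_∈ _) (sym (x∈⁅y⁆⇒x≡y x y∈⁅x⁆)) (∈-interval⁺ ≤-refl (m<m+n (pos x) z<s)))
    (λ y∈ → subst (_∈ ⁅ x ⁆) (sym (pos-injective (single y∈))) (x∈⁅x⁆ x))
    where
    single : ∀ {y} → y ∈ interval (pos x) 1 → pos y ≡ pos x
    single {y} y∈ with ∈-interval⁻ y∈
    ... | x≤y , y<x+1 = ≤-antisym (≤-pred (subst (pos y <_) (+-comm (pos x) 1) y<x+1)) x≤y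

  interval₁≡⁅at⁆ : (a<n : a < n) → interval a 1 ≡ ⁅ at a<n ⁆
  interval₁≡⁅at⁆ a<n = trans (cong (λ c → interval c 1) (sym (pos-at a<n))) (sym ⁅x⁆≡interval)

  -- If b ≥ a + 2, the last two elements of interval b k (k ≥ 2) both lie outside interval a k,
  -- but E has only one element outside it.
  interval-overlap : 2 ≤ k → a < b → b + k ≤ n → interval a k ⊆ E → interval b k ⊆ E →
    ∣ E ∣ ≡ suc k → b ≡ suc a
  interval-overlap {suc zero} (s≤s ())
  interval-overlap {suc (suc k)} {a} {b} {E = E} _ a<b b+k≤n a⊆E b⊆E ∣E∣≡ with b ≤? suc a
  ... | yes b≤1+a = ≤-antisym b≤1+a a<b
  ... | no  b≰1+a = contradiction (trans (sym (pos-at b+k+1<n)) (trans (cong pos z₂≡z₁) (pos-at b+k<n)))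
                                  (λ eq → <-irrefl (sym eq) (+-monoʳ-< b ≤-refl))
    where
    b+k+1<n : b + suc k < n
    b+k+1<n = m+1+n≤o⇒m+n<o b+k≤n
    b+k<n : b + k < n
    b+k<n = <-trans (+-monoʳ-< b ≤-refl) b+k+1<n
    a+k+2≤b+k : a + suc (suc k) ≤ b + k
    a+k+2≤b+k = subst (_≤ b + k) (sym (trans (+-suc a (suc k)) (cong suc (+-suc a k)))) (+-monoˡ-≤ k (≰⇒> b≰1+a))
    z₁ z₂ : Fin n
    z₁ = at b+k<n
    z₂ = at b+k+1<n
    ∣E∣≡suc∣a∣ : ∣ E ∣ ≡ suc ∣ interval a (suc (suc k)) ∣
    ∣E∣≡suc∣a∣ = trans ∣E∣≡ (cong suc (sym (∣interval∣ (<⇒≤ (<-≤-trans (+-monoˡ-< (suc (suc k)) a<b) b+k≤n)))))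
    z₂≡z₁ : z₂ ≡ z₁
    z₂≡z₁ = ∣q∣≡suc∣p∣⇒new-unique a⊆E ∣E∣≡suc∣a∣
      (b⊆E (at∈interval b+k<n (m≤m+n b k) (+-monoʳ-< b (≤-trans (n<1+n k) (n≤1+n _)))))
      (≤pos⇒∉interval (subst (_ ≤_) (sym (pos-at b+k<n)) a+k+2≤b+k))
      (b⊆E (at∈interval b+k+1<n (m≤m+n b (suc k)) (+-monoʳ-< b ≤-refl)))
      (≤pos⇒∉interval (subst (_ ≤_) (sym (pos-at b+k+1<n)) (≤-trans a+k+2≤b+k (+-monoʳ-≤ b (n≤1+n k)))))

  isPrefix-interval : ∀ k → IsPrefix (enum e) k (interval 0 k)
  isPrefix-interval k x = mk⇔
    (λ x∈ → Inverse.from e x , proj₂ (∈-interval⁻ x∈) , Inverse.strictlyInverseˡ e x)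
    (λ { (j , j<k , refl) → ∈-interval⁺ z≤n (subst (_< k) (sym (pos-enum j)) j<k) })

  isSuffix-interval : a + k ≡ n → IsSuffix (enum e) k (interval a k)
  isSuffix-interval {a} {k} a+k≡n x = mk⇔
    (λ x∈ → Inverse.from e x ,
            subst (_≤ pos x + k) a+k≡n (+-monoˡ-≤ k (proj₁ (∈-interval⁻ x∈))) ,
            Inverse.strictlyInverseˡ e x)
    (λ { (j , n≤j+k , refl) → ∈-interval⁺
           (+-cancelʳ-≤ k a _ (subst₂ _≤_ (sym a+k≡n) (cong (_+ k) (sym (pos-enum j))) n≤j+k))
           (subst (pos (enum e j) <_) (sym a+k≡n) (pos<n _)) })

  prefixChain⇔chainOf : ∀ S → PrefixChain (enum e) S ⇔ ChainOf (interval 0) S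
  prefixChain⇔chainOf S = mk⇔
    (λ (k , 1≤k , k≤n , S-prefix) →
       k , 1≤k , k≤n , subset-ext λ x → ⇔-sym (isPrefix-interval k x) ⇔-∘ S-prefix x)
    (λ { (k , 1≤k , k≤n , refl) → k , 1≤k , k≤n , isPrefix-interval k })

  suffixChain⇔chainOf : ∀ S → SuffixChain (enum e) S ⇔ ChainOf (λ k → interval (n ∸ k) k) S
  suffixChain⇔chainOf S = mk⇔
    (λ (k , 1≤k , k≤n , S-suffix) →
       k , 1≤k , k≤n , subset-ext λ x → ⇔-sym (isSuffix-interval (m∸n+n≡m k≤n) x) ⇔-∘ S-suffix x)
    (λ { (k , 1≤k , k≤n , refl) → k , 1≤k , k≤n , isSuffix-interval (m∸n+n≡m k≤n) })

module _ {n : ℕ} (V : Family n) (e : Enumeration n) where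
  open Intervals e

  private
    variable
      a k : ℕ

  prefixChain-maximal : (∀ {S} → InV V S → 1 ≤ ∣ S ∣) →
    (∀ {k} → 1 ≤ k → k ≤ n → InV V (interval 0 k)) → IsMaximalChain V (PrefixChain (enum e))
  prefixChain-maximal V-nonempty prefix∈V =
    isMaximalChain-resp-⇔ V (λ S → ⇔-sym (prefixChain⇔chainOf S))
      (chainOf-maximal V (interval 0) (λ k≤k′ _ → interval-mono ≤-refl k≤k′) ∣interval∣ prefix∈V V-nonempty)

  suffixChain-maximal : (∀ {S} → InV V S → 1 ≤ ∣ S ∣) →
    (∀ {k} → 1 ≤ k → k ≤ n → InV V (interval (n ∸ k) k)) → IsMaximalChain V (SuffixChain (enum e))
  suffixChain-maximal V-nonempty suffix∈V =
    isMaximalChain-resp-⇔ V (λ S → ⇔-sym (suffixChain⇔chainOf S))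
      (chainOf-maximal V (λ k → interval (n ∸ k) k) nested (∣interval∣ ∘ ≤-reflexive ∘ m∸n+n≡m)
                       suffix∈V V-nonempty)
    where
    nested : ∀ {k k′} → k ≤ k′ → k′ ≤ n → interval (n ∸ k) k ⊆ interval (n ∸ k′) k′
    nested k≤k′ k′≤n = interval-mono (∸-monoʳ-≤ n k≤k′)
      (≤-reflexive (trans (m∸n+n≡m (≤-trans k≤k′ k′≤n)) (sym (m∸n+n≡m k′≤n))))

  interval-covers-init : a + suc k ≤ n → InV V (interval a (suc k)) → InV V (interval a k) →
    Covers V (interval a (suc k)) (interval a k)
  interval-covers-init {a} {k} a+k+1≤n E∈V S∈V = ⊂∧∣∣≡suc⇒covers V E∈V S∈V (interval⊂interval-sucʳ a+k+1≤n)
    (trans (∣interval∣ a+k+1≤n) (cong suc (sym (∣interval∣ (≤-trans (+-monoʳ-≤ a (n≤1+n k)) a+k+1≤n)))))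

  interval-covers-tail : a + suc k ≤ n → InV V (interval a (suc k)) → InV V (interval (suc a) k) →
    Covers V (interval a (suc k)) (interval (suc a) k)
  interval-covers-tail {a} {k} a+k+1≤n E∈V S∈V = ⊂∧∣∣≡suc⇒covers V E∈V S∈V (interval⊂interval-sucˡ a+k+1≤n)
    (trans (∣interval∣ a+k+1≤n) (cong suc (sym (∣interval∣ (m+1+n≤o⇒m+n<o a+k+1≤n)))))

  record IsIntervalVine : Set where
    field
      interval∈V     : ∀ {a k} → 1 ≤ k → a + k ≤ n → InV V (interval a k)
      level⇒interval : ∀ {i S} → 1 ≤ i → InLevel V i S → ∃[ a ] (a + i ≤ n × S ≡ interval a i)

  module PathOfIntervals (isIntervalVine : IsIntervalVine) {i : ℕ} (1≤i : 1 ≤ i) (i≤n : i ≤ n) where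
    open IsIntervalVine isIntervalVine

    private
      intervalOfLength : ℕ → Subset n
      intervalOfLength a = interval a i

    levelVertices : List (Subset n)
    levelVertices = applyUpTo intervalOfLength (suc (n ∸ i))

    private
      fits : a < suc (n ∸ i) → a + i ≤ n
      fits {a} a≤n-i = m≤o∸n⇒m+n≤o a i≤n (≤-pred a≤n-i)

      fits⁻ : a + i ≤ n → a < suc (n ∸ i)
      fits⁻ {a} a+i≤n = s≤s (m+n≤o⇒m≤o∸n a a+i≤n)

      interval-level : a + i ≤ n → InLevel V i (interval a i)
      interval-level a+i≤n = interval∈V 1≤i a+i≤n , ∣interval∣ a+i≤n

    levelVertices-unique : Unique levelVertices
    levelVertices-unique = applyUpTo⁺₁ intervalOfLength (suc (n ∸ i)) λ a<b b≤n-i →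
      <⇒≢ a<b ∘ interval-injective 1≤i (fits (<-trans a<b b≤n-i)) (fits b≤n-i)

    level⇔∈levelVertices : ∀ S → InLevel V i S ⇔ S ∈ₗ levelVertices
    level⇔∈levelVertices S = mk⇔ level⇒∈ ∈⇒level
      where
      level⇒∈ : ∀ {S} → InLevel V i S → S ∈ₗ levelVertices
      level⇒∈ S-level with level⇒interval 1≤i S-level
      ... | a , a+i≤n , refl = ∈-applyUpTo⁺ intervalOfLength (fits⁻ a+i≤n)
      ∈⇒level : ∀ {S} → S ∈ₗ levelVertices → InLevel V i S
      ∈⇒level S∈ with ∈-applyUpTo⁻ intervalOfLength S∈
      ... | a , a≤n-i , refl = interval-level (fits a≤n-i)

    adjacent⇒consecutive : ∀ {S T} → Adj V i S T →
      Consecutive V levelVertices S T ⊎ Consecutive V levelVertices T S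
    adjacent⇒consecutive (S-level , T-level , S≢T , E , E-level , E-covers-S , E-covers-T)
      with level⇒interval 1≤i S-level | level⇒interval 1≤i T-level | level⇒interval z<s E-level
    ... | a , a+i≤n , refl | b , b+i≤n , refl | c , c+i+1≤n , refl
      with interval⊆interval-suc⇒ 1≤i a+i≤n (covers⇒⊆ V E-covers-S)
         | interval⊆interval-suc⇒ 1≤i b+i≤n (covers⇒⊆ V E-covers-T)
    ... | inj₁ refl | inj₁ refl = contradiction refl S≢T
    ... | inj₂ refl | inj₂ refl = contradiction refl S≢T
    ... | inj₁ refl | inj₂ refl = inj₁ (applyUpTo-consecutive⁺ intervalOfLength (fits⁻ (m+1+n≤o⇒m+n<o c+i+1≤n)))
    ... | inj₂ refl | inj₁ refl = inj₂ (applyUpTo-consecutive⁺ intervalOfLength (fits⁻ (m+1+n≤o⇒m+n<o c+i+1≤n)))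

    consecutive⇒adjacent : ∀ {S T} → Consecutive V levelVertices S T → Adj V i S T
    consecutive⇒adjacent (_ , _ , vertices≡)
      with applyUpTo-consecutive⁻ intervalOfLength (suc (n ∸ i)) vertices≡
    ... | a , a+1≤n-i , refl , refl =
      interval-level a+i≤n , interval-level a+1+i≤n ,
      1+n≢n ∘ sym ∘ interval-injective 1≤i a+i≤n a+1+i≤n ,
      interval a (suc i) , (E∈V , ∣interval∣ a+i+1≤n) ,
      interval-covers-init a+i+1≤n E∈V (interval∈V 1≤i a+i≤n) ,
      interval-covers-tail a+i+1≤n E∈V (interval∈V 1≤i a+1+i≤n)
      where
      a+1+i≤n : suc a + i ≤ n
      a+1+i≤n = fits a+1≤n-i
      a+i≤n : a + i ≤ n
      a+i≤n = ≤-trans (n≤1+n _) a+1+i≤n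
      a+i+1≤n : a + suc i ≤ n
      a+i+1≤n = m+n<o⇒m+1+n≤o a i a+1+i≤n
      E∈V : InV V (interval a (suc i))
      E∈V = interval∈V z<s a+i+1≤n

  level-isPathGraph : IsIntervalVine → ∀ {i} → 1 ≤ i → i ≤ n ∸ 1 → IsPathGraph V i
  level-isPathGraph isIntervalVine 1≤i i≤n-1 =
    levelVertices , levelVertices-unique , level⇔∈levelVertices ,
    λ S T → mk⇔ adjacent⇒consecutive [ consecutive⇒adjacent , adj-sym V ∘ consecutive⇒adjacent ]
    where open PathOfIntervals isIntervalVine 1≤i (≤-trans i≤n-1 (m∸n≤m n 1))

module Chains⇒IntervalVine {n : ℕ} {V : Family n} (rv : IsRegularVine V) (e : Enumeration n)
  (prefix∈V : ∀ {k} → 1 ≤ k → k ≤ n → InV V (Intervals.interval e 0 k))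
  (suffix∈V : ∀ {a k} → 1 ≤ k → a + k ≡ n → InV V (Intervals.interval e a k)) where
  open IsRegularVine rv
  open RegularVine rv
  open Intervals e

  private
    variable
      a i : ℕ
      S : Subset n

  -- By proximity the two intervals of length i + 1 cover a common element: their intersection.
  interval∈V-by-proximity : 1 ≤ i → suc a + suc i ≤ n → InV V (interval a (suc (suc i))) →
    InV V (interval a (suc i)) → InV V (interval (suc a) (suc i)) → InV V (interval (suc a) i)
  interval∈V-by-proximity {i} {a} 1≤i a+i+2≤n E∈V S∈V T∈V
    with proximity (suc i) (s≤s 1≤i) _ _ _ (S∈V , ∣interval∣ a+i+1≤n) (T∈V , ∣interval∣ a+i+2≤n)
           (interval-covers-init V e a+i+2≤n′ E∈V S∈V) (interval-covers-tail V e a+i+2≤n′ E∈V T∈V)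
    where
    a+i+2≤n′ : a + suc (suc i) ≤ n
    a+i+2≤n′ = m+n<o⇒m+1+n≤o a (suc i) a+i+2≤n
    a+i+1≤n : a + suc i ≤ n
    a+i+1≤n = <⇒≤ a+i+2≤n
  ... | U , S-covers-U , T-covers-U = subst (InV V) U≡ (proj₁ (proj₂ S-covers-U))
    where
    ∣U∣≡i : ∣ U ∣ ≡ i
    ∣U∣≡i = suc-injective (trans (sym (rank-card _ _ S-covers-U)) (∣interval∣ (<⇒≤ a+i+2≤n)))
    U≡ : U ≡ interval (suc a) i
    U≡ = ⊆∧∣∣≤⇒≡ (λ x∈U → interval-∩ (covers⇒⊆ V S-covers-U x∈U) (covers⇒⊆ V T-covers-U x∈U))
                 (≤-reflexive (trans (∣interval∣ (≤-trans (+-monoʳ-≤ (suc a) (n≤1+n i)) a+i+2≤n)) (sym ∣U∣≡i)))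

  interval∈V-of-corank : ∀ d a → 1 ≤ i → d + i ≡ n → a + i ≤ n → InV V (interval a i)
  interval∈V-of-corank d zero 1≤i _ i≤n = prefix∈V 1≤i i≤n
  interval∈V-of-corank {i} d (suc a) 1≤i d+i≡n a+i≤n with suc a + i ≟ n
  ... | yes a+i≡n = suffix∈V 1≤i a+i≡n
  ... | no  a+i≢n = inner d d+i≡n (≤∧≢⇒< a+i≤n a+i≢n)
    where
    inner : ∀ d → d + i ≡ n → suc a + i < n → InV V (interval (suc a) i)
    inner zero          i≡n   a+i<n = contradiction (subst (_≤ suc a + i) i≡n (m≤n+m i (suc a))) (<⇒≱ a+i<n)
    inner (suc zero)    1+i≡n a+i<n = contradiction (subst (_≤ suc a + i) 1+i≡n (s≤s (m≤n+m i a))) (<⇒≱ a+i<n)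
    inner (suc (suc d)) d+i≡n a+i<n = interval∈V-by-proximity 1≤i a+1+i+1≤n
      (interval∈V-of-corank d a z<s (trans (+-suc d (suc i)) d+1+i≡n) a+i+2≤n)
      (interval∈V-of-corank (suc d) a z<s d+1+i≡n (<⇒≤ a+1+i+1≤n))
      (interval∈V-of-corank (suc d) (suc a) z<s d+1+i≡n a+1+i+1≤n)
      where
      d+1+i≡n : suc d + suc i ≡ n
      d+1+i≡n = trans (+-suc (suc d) i) d+i≡n
      a+1+i+1≤n : suc a + suc i ≤ n
      a+1+i+1≤n = m+n<o⇒m+1+n≤o (suc a) i a+i<n
      a+i+2≤n : a + suc (suc i) ≤ n
      a+i+2≤n = m+n<o⇒m+1+n≤o a (suc i) a+1+i+1≤n

  interval∈V : 1 ≤ i → a + i ≤ n → InV V (interval a i)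
  interval∈V {i} {a} 1≤i a+i≤n = interval∈V-of-corank (n ∸ i) a 1≤i (m∸n+n≡m (m+n≤o⇒n≤o a a+i≤n)) a+i≤n

  interval-level : 1 ≤ i → a + i ≤ n → InLevel V i (interval a i)
  interval-level 1≤i a+i≤n = interval∈V 1≤i a+i≤n , ∣interval∣ a+i≤n

  another-vertex : 1 ≤ i → i < n → ∀ S → ∃[ T ] (InLevel V i T × S ≢ T)
  another-vertex {i} 1≤i i<n S with ≡-dec Bool._≟_ S (interval 0 i)
  ... | yes refl = interval 1 i , interval-level 1≤i i<n , 0≢1+n ∘ interval-injective 1≤i (<⇒≤ i<n) i<n
  ... | no  S≢I  = interval 0 i , interval-level 1≤i (<⇒≤ i<n) , S≢I

  covered-by-interval : ∀ {c} → 1 ≤ i → c + suc i ≤ n → Covers V (interval c (suc i)) S →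
    S ≡ interval c i ⊎ S ≡ interval (suc c) i
  covered-by-interval {i} {S} {c} 1≤i c+i+1≤n E-covers-S =
    covers-one-of (subst (2 ≤_) (sym (∣interval∣ c+i+1≤n)) (s≤s 1≤i))
      (interval-covers-init V e c+i+1≤n E∈V (interval∈V 1≤i c+i≤n))
      (interval-covers-tail V e c+i+1≤n E∈V (interval∈V 1≤i c+1+i≤n))
      (1+n≢n ∘ sym ∘ interval-injective 1≤i c+i≤n c+1+i≤n) E-covers-S
    where
    E∈V = proj₁ E-covers-S
    c+1+i≤n : suc c + i ≤ n
    c+1+i≤n = m+1+n≤o⇒m+n<o c+i+1≤n
    c+i≤n : c + i ≤ n
    c+i≤n = ≤-trans (n≤1+n _) c+1+i≤n

  level⇒interval-of-corank : ∀ d → 1 ≤ i → d + i ≡ n → InLevel V i S → ∃[ a ] (a + i ≤ n × S ≡ interval a i)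
  level⇒interval-of-corank {i} {S} zero _ i≡n (_ , ∣S∣≡i) =
    0 , ≤-reflexive i≡n , ⊆∧∣∣≤⇒≡ S⊆I (≤-reflexive (trans (∣interval∣ (≤-reflexive i≡n)) (sym ∣S∣≡i)))
    where
    S⊆I : S ⊆ interval 0 i
    S⊆I {x} _ = ∈-interval⁺ z≤n (subst (pos x <_) (sym i≡n) (pos<n x))
  level⇒interval-of-corank {i} {S} (suc d) 1≤i d+i≡n S-level
    with i<n ← subst (i <_) d+i≡n (m<n+m i z<s) | another-vertex 1≤i i<n S
  ... | T , T-level , S≢T with covered-at-next-level 1≤i i<n S-level T-level S≢T
  ... | E , E-level , E-covers-S with level⇒interval-of-corank d z<s (trans (+-suc d i) d+i≡n) E-level
  ... | c , c+i+1≤n , refl with covered-by-interval 1≤i c+i+1≤n E-covers-S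
  ... | inj₁ S≡ = c , <⇒≤ (m+1+n≤o⇒m+n<o c+i+1≤n) , S≡
  ... | inj₂ S≡ = suc c , m+1+n≤o⇒m+n<o c+i+1≤n , S≡

  isIntervalVine : IsIntervalVine V e
  isIntervalVine = record
    { interval∈V     = interval∈V
    ; level⇒interval = λ {i} {S} 1≤i S-level →
        level⇒interval-of-corank (n ∸ i) 1≤i (m∸n+n≡m (subst (_≤ n) (proj₂ S-level) (∣p∣≤n S))) S-level
    }

module DVine⇒IntervalVine {n : ℕ} {V : Family n} (rv : IsRegularVine V) (e : Enumeration n)
  (adjacent-singletons : ∀ {x y} → Adj V 1 ⁅ x ⁆ ⁅ y ⁆ →
     Intervals.pos e y ≡ suc (Intervals.pos e x) ⊎ Intervals.pos e x ≡ suc (Intervals.pos e y)) where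
  open IsRegularVine rv
  open RegularVine rv
  open Intervals e

  private
    variable
      a b i : ℕ
      E S : Subset n

  ∣cover∣ : Covers V E (interval a i) → a + i ≤ n → ∣ E ∣ ≡ suc i
  ∣cover∣ E-covers a+i≤n = trans (rank-card _ _ E-covers) (cong suc (∣interval∣ a+i≤n))

  common-cover⇒adjacent : 1 ≤ i → a + i ≤ n → b + i ≤ n →
    Covers V E (interval a i) → Covers V E (interval b i) → a ≢ b → b ≡ suc a ⊎ a ≡ suc b
  common-cover⇒adjacent {suc zero} {a} {b} {E} _ a+1≤n b+1≤n E-covers-a E-covers-b a≢b =
    subst₂ (λ p q → q ≡ suc p ⊎ p ≡ suc q) (pos-at a<n) (pos-at b<n)
      (adjacent-singletons (subst₂ (Adj V 1) (interval₁≡⁅at⁆ a<n) (interval₁≡⁅at⁆ b<n) adjacent))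
    where
    a<n : a < n
    a<n = subst (_≤ n) (+-comm a 1) a+1≤n
    b<n : b < n
    b<n = subst (_≤ n) (+-comm b 1) b+1≤n
    adjacent : Adj V 1 (interval a 1) (interval b 1)
    adjacent = covered-level E-covers-a (∣cover∣ E-covers-a a+1≤n) ,
               covered-level E-covers-b (∣cover∣ E-covers-b b+1≤n) ,
               a≢b ∘ interval-injective z<s a+1≤n b+1≤n ,
               E , (proj₁ E-covers-a , ∣cover∣ E-covers-a a+1≤n) , E-covers-a , E-covers-b
  common-cover⇒adjacent {suc (suc i)} {a} {b} _ a+i≤n b+i≤n E-covers-a E-covers-b a≢b with <-cmp a b
  ... | tri< a<b _ _ = inj₁ (interval-overlap (s≤s z<s) a<b b+i≤n (covers⇒⊆ V E-covers-a) (covers⇒⊆ V E-covers-b)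
                                              (∣cover∣ E-covers-a a+i≤n))
  ... | tri≈ _ a≡b _ = contradiction a≡b a≢b
  ... | tri> _ _ b<a = inj₂ (interval-overlap (s≤s z<s) b<a a+i≤n (covers⇒⊆ V E-covers-b) (covers⇒⊆ V E-covers-a)
                                              (∣cover∣ E-covers-b b+i≤n))

  common-cover≡interval : 1 ≤ i → suc a + i ≤ n →
    Covers V E (interval a i) → Covers V E (interval (suc a) i) → E ≡ interval a (suc i)
  common-cover≡interval {i} {a} 1≤i a+1+i≤n E-covers-a E-covers-a+1 = sym (⊆∧∣∣≤⇒≡
    (λ x∈ → [ covers⇒⊆ V E-covers-a , covers⇒⊆ V E-covers-a+1 ] (interval-∪ 1≤i x∈))
    (≤-reflexive (trans (∣cover∣ E-covers-a a+i≤n) (sym (∣interval∣ (m+n<o⇒m+1+n≤o a i a+1+i≤n))))))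
    where
    a+i≤n : a + i ≤ n
    a+i≤n = ≤-trans (n≤1+n _) a+1+i≤n

  common-cover⇒interval : 1 ≤ i → a + i ≤ n → b + i ≤ n →
    Covers V E (interval a i) → Covers V E (interval b i) → a ≢ b →
    (b ≡ suc a × E ≡ interval a (suc i)) ⊎ (a ≡ suc b × E ≡ interval b (suc i))
  common-cover⇒interval 1≤i a+i≤n b+i≤n E-covers-a E-covers-b a≢b
    with common-cover⇒adjacent 1≤i a+i≤n b+i≤n E-covers-a E-covers-b a≢b
  ... | inj₁ refl = inj₁ (refl , common-cover≡interval 1≤i b+i≤n E-covers-a E-covers-b)
  ... | inj₂ refl = inj₂ (refl , common-cover≡interval 1≤i a+i≤n E-covers-b E-covers-a)

  IntervalLevel : ℕ → Set
  IntervalLevel i = (∀ {a} → a + i ≤ n → InV V (interval a i))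
                  × (∀ {S} → InLevel V i S → ∃[ a ] (a + i ≤ n × S ≡ interval a i))

  intervalLevel₁ : IntervalLevel 1
  intervalLevel₁ =
    (λ {a} a+1≤n → subst (InV V) (sym (interval₁≡⁅at⁆ (subst (_≤ n) (+-comm a 1) a+1≤n))) (singletons-in _)) ,
    λ S-level → singleton⇒interval (Equivalence.to level₁⇔singleton S-level)
    where
    singleton⇒interval : (∃[ x ] S ≡ ⁅ x ⁆) → ∃[ a ] (a + 1 ≤ n × S ≡ interval a 1)
    singleton⇒interval (x , refl) = pos x , subst (_≤ n) (+-comm 1 (pos x)) (pos<n x) , ⁅x⁆≡interval

  module _ (1≤i : 1 ≤ i) (i<n : i < n) (interval∈V : ∀ {a} → a + i ≤ n → InV V (interval a i))
           (level⇒interval : ∀ {S} → InLevel V i S → ∃[ a ] (a + i ≤ n × S ≡ interval a i)) where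

    -- A walk in the tree on V(i) from an interval starting at b ≤ a to one starting at b′ > a
    -- moves one position per edge, so it must use the edge between positions a and a + 1.
    crossing-edge∈V : ∀ {a b b′ X Y} → Star (Adj V i) X Y → X ≡ interval b i → b + i ≤ n → b ≤ a →
      Y ≡ interval b′ i → b′ + i ≤ n → a < b′ → InV V (interval a (suc i))
    crossing-edge∈V ε refl b+i≤n b≤a Y≡ b′+i≤n a<b′ =
      contradiction (interval-injective 1≤i b+i≤n b′+i≤n Y≡) λ { refl → <⇒≱ a<b′ b≤a }
    crossing-edge∈V {a} {b} ((_ , M-level , X≢M , E , E-level , E-covers-X , E-covers-M) ◅ walk) refl b+i≤n b≤a Y≡ b′+i≤n a<b′
      with level⇒interval M-level
    ... | m , m+i≤n , refl with common-cover⇒interval 1≤i b+i≤n m+i≤n E-covers-X E-covers-M (X≢M ∘ cong (λ c → interval c i))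
    ... | inj₂ (refl , _) = crossing-edge∈V walk refl m+i≤n (≤-trans (n≤1+n m) b≤a) Y≡ b′+i≤n a<b′
    ... | inj₁ (refl , E≡) with b ≟ a
    ...   | yes refl = subst (InV V) E≡ (proj₁ E-level)
    ...   | no  b≢a  = crossing-edge∈V walk refl m+i≤n (≤∧≢⇒< b≤a b≢a) Y≡ b′+i≤n a<b′

    next-interval∈V : a + suc i ≤ n → InV V (interval a (suc i))
    next-interval∈V {a} a+i+1≤n = crossing-edge∈V
      (proj₁ (trees i 1≤i (m<n⇒m≤n∸1 i<n)) _ _ (level a+i≤n) (level a+1+i≤n))
      refl a+i≤n ≤-refl refl a+1+i≤n (n<1+n a)
      where
      a+1+i≤n : suc a + i ≤ n
      a+1+i≤n = m+1+n≤o⇒m+n<o a+i+1≤n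
      a+i≤n : a + i ≤ n
      a+i≤n = ≤-trans (n≤1+n _) a+1+i≤n
      level : ∀ {c} → c + i ≤ n → InLevel V i (interval c i)
      level c+i≤n = interval∈V c+i≤n , ∣interval∣ c+i≤n

    next-level⇒interval : InLevel V (suc i) S → ∃[ a ] (a + suc i ≤ n × S ≡ interval a (suc i))
    next-level⇒interval {S} (S∈V , ∣S∣≡)
      with two-covers S S∈V (¬minimal S∈V (subst (2 ≤_) (sym ∣S∣≡) (s≤s 1≤i)))
    ... | S₁ , S₂ , S₁≢S₂ , S-covers-S₁ , S-covers-S₂ , _
      with level⇒interval (covered-level S-covers-S₁ ∣S∣≡) | level⇒interval (covered-level S-covers-S₂ ∣S∣≡)
    ... | a , a+i≤n , refl | b , b+i≤n , refl
      with common-cover⇒interval 1≤i a+i≤n b+i≤n S-covers-S₁ S-covers-S₂ (S₁≢S₂ ∘ cong (λ c → interval c i))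
    ... | inj₁ (refl , S≡) = a , m+n<o⇒m+1+n≤o a i b+i≤n , S≡
    ... | inj₂ (refl , S≡) = b , m+n<o⇒m+1+n≤o b i a+i≤n , S≡

  intervalLevel : 1 ≤ i → i ≤ n → IntervalLevel i
  intervalLevel {suc zero}    _ _     = intervalLevel₁
  intervalLevel {suc (suc i)} _ i+2≤n with intervalLevel {suc i} z<s (<⇒≤ i+2≤n)
  ... | interval∈V , level⇒interval =
    next-interval∈V z<s i+2≤n interval∈V level⇒interval , next-level⇒interval z<s i+2≤n interval∈V level⇒interval

  isIntervalVine : IsIntervalVine V e
  isIntervalVine = record
    { interval∈V     = λ {a} 1≤k a+k≤n → proj₁ (intervalLevel 1≤k (m+n≤o⇒n≤o a a+k≤n)) a+k≤n
    ; level⇒interval = λ {i} {S} 1≤i S-level →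
        proj₂ (intervalLevel 1≤i (subst (_≤ n) (proj₂ S-level) (∣p∣≤n S))) S-level
    }

pathGraph₁⇒enumeration : ∀ {n} {V : Family n} → IsRegularVine V → IsPathGraph V 1 →
  Σ (Enumeration n) λ e → ∀ {x y} → Adj V 1 ⁅ x ⁆ ⁅ y ⁆ →
    Intervals.pos e y ≡ suc (Intervals.pos e x) ⊎ Intervals.pos e x ≡ suc (Intervals.pos e y)
pathGraph₁⇒enumeration rv (vertices , unique , level⇔∈ , adj⇔consecutive) = listEnumeration , adjacent
  where
  open RegularVine rv
  open ListEnumeration (≡-dec Bool._≟_) ⁅⁆-injective unique
    (λ x → Equivalence.to (level⇔∈ ⁅ x ⁆) (Equivalence.from level₁⇔singleton (x , refl)))
    (λ y∈ → Equivalence.to level₁⇔singleton (Equivalence.from (level⇔∈ _) y∈))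
  adjacent : ∀ {x y} → Adj _ 1 ⁅ x ⁆ ⁅ y ⁆ → position y ≡ suc (position x) ⊎ position x ≡ suc (position y)
  adjacent adj with Equivalence.to (adj⇔consecutive _ _) adj
  ... | inj₁ (l , _ , vertices≡) = inj₁ (position-consecutive l (sym vertices≡))
  ... | inj₂ (l , _ , vertices≡) = inj₂ (position-consecutive l (sym vertices≡))

proposition2p16 : (n : ℕ) → 2 ≤ n → (V : Family n) → IsRegularVine V →
    IsDVine V ⇔ (Σ (Enumeration n) λ e → IsMaximalChain V (PrefixChain (enum e))
                                          × IsMaximalChain V (SuffixChain (enum e)))
proposition2p16 n 2≤n V rv = mk⇔ dvine⇒chains chains⇒dvine
  where
  open RegularVine rv using (∈V⇒1≤∣∣)

  dvine⇒chains : IsDVine V → Σ (Enumeration n) λ e →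
    IsMaximalChain V (PrefixChain (enum e)) × IsMaximalChain V (SuffixChain (enum e))
  dvine⇒chains (_ , paths) with pathGraph₁⇒enumeration rv (paths 1 ≤-refl (m<n⇒m≤n∸1 2≤n))
  ... | e , adjacent-singletons =
    e , prefixChain-maximal V e ∈V⇒1≤∣∣ interval∈V ,
        suffixChain-maximal V e ∈V⇒1≤∣∣ (λ 1≤k k≤n → interval∈V 1≤k (≤-reflexive (m∸n+n≡m k≤n)))
    where open IsIntervalVine (DVine⇒IntervalVine.isIntervalVine rv e adjacent-singletons)

  chains⇒dvine : (Σ (Enumeration n) λ e →
    IsMaximalChain V (PrefixChain (enum e)) × IsMaximalChain V (SuffixChain (enum e))) → IsDVine V
  chains⇒dvine (e , (prefix⊆V , _) , (suffix⊆V , _)) =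
    rv , λ i 1≤i i≤n-1 → level-isPathGraph V e isIntervalVine 1≤i i≤n-1
    where
    open Intervals e
    isIntervalVine : IsIntervalVine V e
    isIntervalVine = Chains⇒IntervalVine.isIntervalVine rv e
      (λ {k} 1≤k k≤n → prefix⊆V _ (k , 1≤k , k≤n , isPrefix-interval k))
      (λ {a} {k} 1≤k a+k≡n → suffix⊆V _ (k , 1≤k , subst (k ≤_) a+k≡n (m≤n+m k a) , isSuffix-interval a+k≡n))
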